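{- Let $e_1,e_2$ be integers with $e_1\ge e_2>1$ and let $P=\{t_1=\{a^{e_1}\},t_2=\{\hat a^{e_2}\},t_3=\{\hat a\}\}$. Let $G$ be a graph realized by $P$ with tile distribution $(R_1,R_2,R_3)$. If $1+R_2(e_2-1)<R_1$, then $G$ is disconnected.
   Context: Graphs are loopless multigraphs. A tile is a vertex with half-edges (cohesive ends) labeled by letters; $\{a^{e}\}$ denotes a tile with $e$ cohesive ends of type $a$, and $\{\hat a^{e}\}$ a tile with $e$ cohesive ends of the complementary type $\hat a$. A pot is a set of tile types. A graph $G$ is realized by a pot $P$ if each vertex $v$ can be assigned a tile type $t\in P$ together with a bijection between the cohesive ends of $t$ and the edge-ends (half-edges) at $v$, such that for every edge the two half-edges are assigned complementary cohesive ends ($a$ and $\hat a$). The tile distribution $(R_1,R_2,R_3)$ of such a realization records that exactly $R_k$ vertices are assigned tile type $t_k$. -}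

module Defs where

open import Data.Nat using (ℕ; zero; suc)
open import Data.Fin using (Fin; zero; suc)
open import Data.Fin.Properties using (_≟_)
open import Data.Bool using (Bool; true; false)
open import Data.List using (List; []; _∷_; length; lookup; replicate; filter; allFin)
open import Data.List.Relation.Unary.All using (All)
open import Data.Product using (Σ; _×_; _,_; proj₁; proj₂; ∃-syntax)
open import Data.Empty using (⊥)
open import Data.Sum using (_⊎_)
open import Function.Bundles using (_↔_; Inverse)
open import Relation.Binary.PropositionalEquality using (_≡_; _≢_; refl)
open import Relation.Nullary using (¬_)

Letter : Set
Letter = ℕ

data End : Set where
  plain : Letter → End
  hat   : Letter → End

complementary : End → End → Set
complementary (plain a) (hat b)   = a ≡ b
complementary (hat a)   (plain b) = a ≡ b
complementary (plain _) (plain _) = ⊥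
complementary (hat _)   (hat _)   = ⊥

-- A tile type: the multiset of its cohesive ends, given as a list.
Tile : Set
Tile = List End

Pot : ℕ → Set
Pot k = Fin k → Tile

-- A finite loopless multigraph on vertex set Fin n; edges form a list
-- (so parallel edges are allowed), each edge an ordered pair of distinct endpoints.
record Graph : Set where
  field
    n        : ℕ
    edges    : List (Fin n × Fin n)
    loopless : All (λ e → proj₁ e ≢ proj₂ e) edges

module _ (G : Graph) where
  open Graph G

  Edge : Set
  Edge = Fin (length edges)

  HalfEdge : Set
  HalfEdge = Edge × Bool

  endpoint : HalfEdge → Fin n
  endpoint (i , false) = proj₁ (lookup edges i)
  endpoint (i , true)  = proj₂ (lookup edges i)

  HalfEdgeAt : Fin n → Set
  HalfEdgeAt v = Σ HalfEdge (λ h → endpoint h ≡ v)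

  Adjacent : Fin n → Fin n → Set
  Adjacent u v = ∃[ i ] ((proj₁ (lookup edges i) ≡ u × proj₂ (lookup edges i) ≡ v)
                       ⊎ (proj₁ (lookup edges i) ≡ v × proj₂ (lookup edges i) ≡ u))

  data Reachable : Fin n → Fin n → Set where
    here : ∀ {v} → Reachable v v
    step : ∀ {u v w} → Adjacent u v → Reachable v w → Reachable u w

  Connected : Set
  Connected = ∀ u v → Reachable u v

  Disconnected : Set
  Disconnected = ¬ Connected

record Assignment (G : Graph) {k : ℕ} (P : Pot k) : Set where
  open Graph G
  field
    tileOf : Fin n → Fin k
    ends   : (v : Fin n) → Fin (length (P (tileOf v))) ↔ HalfEdgeAt G v

labelOf : {G : Graph} {k : ℕ} {P : Pot k} → Assignment G P → HalfEdge G → End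
labelOf {G} {k} {P} A h =
  lookup (P (tileOf (endpoint G h))) (Inverse.from (ends (endpoint G h)) (h , refl))
  where open Assignment A

record Realization (G : Graph) {k : ℕ} (P : Pot k) : Set where
  field
    assignment : Assignment G P
    compatible : (i : Edge G) →
      complementary (labelOf assignment (i , false)) (labelOf assignment (i , true))

tileCount : {G : Graph} {k : ℕ} {P : Pot k} → Realization G P → Fin k → ℕ
tileCount {G} r j =
  length (filter (λ v → Assignment.tileOf (Realization.assignment r) v ≟ j) (allFin (Graph.n G)))

a : Letter
a = 0

-- P = { t₁ = {a^e₁}, t₂ = {â^e₂}, t₃ = {â} }  (indexed 0,1,2)
pot4 : ℕ → ℕ → Pot 3
pot4 e₁ e₂ zero             = replicate e₁ (plain a)
pot4 e₁ e₂ (suc zero)       = replicate e₂ (hat a)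
pot4 e₁ e₂ (suc (suc zero)) = hat a ∷ []

{-# OPTIONS --safe #-}
-- Each edge joins an a end to an â end, and â ends occur only on t₂ (e₂ of them)
-- and t₃ (one), so |E| ≤ e₂R₂ + R₃. A connected graph on n = R₁ + R₂ + R₃
-- vertices has at least n − 1 edges; together these give R₁ ≤ 1 + R₂(e₂ − 1).
module Submission where

open import Defs
open import Data.Nat using (ℕ; zero; suc; _+_; _*_; _∸_; _≤_; _<_; z≤n; s≤s)
open import Data.Fin using (Fin; zero; suc; toℕ; punchIn; punchOut)

open import Data.Bool using (Bool; true; false)
open import Data.Empty using (⊥-elim)
open import Data.Fin.Properties using (_≟_; ¬Fin0; punchOut-cong; punchOut-punchIn; punchInᵢ≢i; toℕ-injective; toℕ<n; injective⇒≤)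
open import Data.List using (List; []; _∷_; length; lookup; filter; allFin; map; upTo; _++_)
open import Data.List.Membership.Propositional using (_∈_)
open import Data.List.Membership.Propositional.Properties using (∈-map⁺; ∈-++⁺ˡ; ∈-++⁺ʳ; ∈-upTo⁺; ∈-allFin; ∈-lookup)
open import Data.List.Membership.Setoid.Properties using (index-injective)
open import Data.List.Properties using (length-++; length-map; length-upTo; length-replicate; length-tabulate)
open import Data.List.Relation.Unary.All as All using (All; []; _∷_)
open import Data.List.Relation.Unary.All.Properties using (replicate⁺)
open import Data.List.Relation.Unary.Any using (here; there; index)
open import Data.Nat.ListAction using (sum)
open import Data.Nat.Properties using (+-suc; +-assoc; ≤-trans; n≤1+n; m≤m+n; +-monoˡ-≤; +-monoʳ-≤; +-monoʳ-<; <-irrefl; +-commutativeSemigroup; module ≤-Reasoning)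
open import Algebra.Properties.CommutativeSemigroup +-commutativeSemigroup using (x∙yz≈y∙xz)
open import Data.Product using (∃; ∃₂; _×_; _,_; proj₁; proj₂)
open import Data.Sum using (inj₁; inj₂)
open import Function using (_∘_)
open import Function.Bundles using (Inverse)
open import Function.Definitions using (Injective)
open import Relation.Binary.PropositionalEquality using (_≡_; _≢_; refl; sym; trans; cong; cong₂; subst; setoid; module ≡-Reasoning)
open import Relation.Nullary using (yes; no; contradiction)

identify : ∀ {k} {i j : Fin (suc k)} → i ≢ j → Fin (suc k) → Fin k
identify {i = i} {j} i≢j x with x ≟ j
... | yes _   = punchOut (i≢j ∘ sym)
... | no x≢j = punchOut (x≢j ∘ sym)

identify-identifies : ∀ {k} {i j : Fin (suc k)} (i≢j : i ≢ j) → identify i≢j i ≡ identify i≢j j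
identify-identifies {i = i} {j} i≢j with i ≟ j | j ≟ j
... | yes i≡j | _       = contradiction i≡j i≢j
... | no _    | yes _   = punchOut-cong j refl
... | no _    | no j≢j = contradiction refl j≢j

identify-punchIn : ∀ {k} {i j : Fin (suc k)} (i≢j : i ≢ j) y → identify i≢j (punchIn j y) ≡ y
identify-punchIn {j = j} i≢j y with punchIn j y ≟ j
... | yes eq = contradiction eq (punchInᵢ≢i j y)
... | no _   = trans (punchOut-cong j refl) (punchOut-punchIn j)

-- Built one edge at a time: an edge between two colour classes merges them, so
-- colours + |E| never drops below n.
record EdgeInvariantColouring {n : ℕ} (E : List (Fin n × Fin n)) : Set where
  field
    colours   : ℕ
    colour    : Fin n → Fin colours
    onto      : ∀ c → ∃ λ v → colour v ≡ c
    invariant : All (λ e → colour (proj₁ e) ≡ colour (proj₂ e)) E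
    n≤colours+∣E∣ : n ≤ colours + length E

module _ {n : ℕ} {E : List (Fin n × Fin n)} (u v : Fin n) where
  open EdgeInvariantColouring

  mergeColours : (C : EdgeInvariantColouring E) → colour C u ≢ colour C v →
                 EdgeInvariantColouring ((u , v) ∷ E)
  mergeColours record { colours = zero ; colour = c } _ = ⊥-elim (¬Fin0 (c u))
  mergeColours record { colours = suc k ; colour = c ; onto = onto ; invariant = inv ; n≤colours+∣E∣ = bound } cu≢cv =
    record
      { colours   = k
      ; colour    = merge ∘ c
      ; onto      = λ y → let (x , cx≡) = onto (punchIn (c v) y) in
                          x , trans (cong merge cx≡) (identify-punchIn cu≢cv y)
      ; invariant = identify-identifies cu≢cv ∷ All.map (cong merge) inv
      ; n≤colours+∣E∣ = subst (n ≤_) (sym (+-suc k (length E))) bound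
      }
    where
    merge : Fin (suc k) → Fin k
    merge = identify cu≢cv

  addEdge : EdgeInvariantColouring E → EdgeInvariantColouring ((u , v) ∷ E)
  addEdge C with colour C u ≟ colour C v
  ... | no cu≢cv = mergeColours C cu≢cv
  ... | yes cu≡cv = record
    { colours   = colours C
    ; colour    = colour C
    ; onto      = onto C
    ; invariant = cu≡cv ∷ invariant C
    ; n≤colours+∣E∣ = ≤-trans (n≤colours+∣E∣ C) (+-monoʳ-≤ (colours C) (n≤1+n _))
    }

edgeInvariantColouring : ∀ {n} (E : List (Fin n × Fin n)) → EdgeInvariantColouring E
edgeInvariantColouring {n} [] = record
  { colours = n ; colour = λ x → x ; onto = λ c → c , refl ; invariant = [] ; n≤colours+∣E∣ = m≤m+n n 0 }
edgeInvariantColouring ((u , v) ∷ E) = addEdge u v (edgeInvariantColouring E)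

constant-onto⇒≤1 : ∀ {A : Set} {k} (c : A → Fin k) → (∀ j → ∃ λ x → c x ≡ j) → (∀ x y → c x ≡ c y) → k ≤ 1
constant-onto⇒≤1 {k = zero}        _ _ _ = z≤n
constant-onto⇒≤1 {k = suc zero}    _ _ _ = s≤s z≤n
constant-onto⇒≤1 {k = suc (suc _)} c onto constant with onto zero | onto (suc zero)
... | x , cx≡0 | y , cy≡1 = contradiction (trans (sym cx≡0) (trans (constant x y) cy≡1)) λ ()

module _ (G : Graph) where
  open Graph G

  reachable⇒colour≡ : ∀ {k} (c : Fin n → Fin k) → All (λ e → c (proj₁ e) ≡ c (proj₂ e)) edges →
                      ∀ {x y} → Reachable G x y → c x ≡ c y
  reachable⇒colour≡ c inv here = refl
  reachable⇒colour≡ c inv (step (i , inj₁ (refl , refl)) r) =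
    trans (All.lookup inv (∈-lookup i)) (reachable⇒colour≡ c inv r)
  reachable⇒colour≡ c inv (step (i , inj₂ (refl , refl)) r) =
    trans (sym (All.lookup inv (∈-lookup i))) (reachable⇒colour≡ c inv r)

  connected⇒n≤1+∣E∣ : Connected G → n ≤ suc (length edges)
  connected⇒n≤1+∣E∣ conn = ≤-trans n≤colours+∣E∣ (+-monoˡ-≤ (length edges) colours≤1)
    where
    open EdgeInvariantColouring (edgeInvariantColouring edges)
    colours≤1 : colours ≤ 1
    colours≤1 = constant-onto⇒≤1 colour onto λ x y → reachable⇒colour≡ colour invariant (conn x y)

injective-into-list⇒≤ : ∀ {A : Set} {m} (xs : List A) (f : Fin m → A) →
                        Injective _≡_ _≡_ f → (∀ i → f i ∈ xs) → m ≤ length xs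
injective-into-list⇒≤ xs f f-inj f∈xs = injective⇒≤ {f = index ∘ f∈xs}
  λ {i} {j} eq → f-inj (index-injective (setoid _) (f∈xs i) (f∈xs j) eq)

slots : ∀ {n} (w : Fin n → ℕ) → List (Fin n) → List (Fin n × ℕ)
slots w []       = []
slots w (v ∷ vs) = map (v ,_) (upTo (w v)) ++ slots w vs

length-slots : ∀ {n} (w : Fin n → ℕ) vs → length (slots w vs) ≡ sum (map w vs)
length-slots w []       = refl
length-slots w (v ∷ vs) = begin
  length (map (v ,_) (upTo (w v)) ++ slots w vs)          ≡⟨ length-++ (map (v ,_) (upTo (w v))) ⟩
  length (map (v ,_) (upTo (w v))) + length (slots w vs)  ≡⟨ cong₂ _+_ (trans (length-map (v ,_) (upTo (w v))) (length-upTo (w v))) (length-slots w vs) ⟩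
  w v + sum (map w vs)                                    ∎
  where open ≡-Reasoning

∈-slots : ∀ {n} (w : Fin n → ℕ) {vs v k} → v ∈ vs → k < w v → (v , k) ∈ slots w vs
∈-slots w {v ∷ _}  (here refl) k<wv = ∈-++⁺ˡ (∈-map⁺ (v ,_) (∈-upTo⁺ k<wv))
∈-slots w {u ∷ _} (there v∈vs) k<wv = ∈-++⁺ʳ (map (u ,_) (upTo (w u))) (∈-slots w v∈vs k<wv)

HatsWithin : ∀ {k} → Pot k → (Fin k → ℕ) → Set
HatsWithin P w = ∀ j ix {b} → lookup (P j) ix ≡ hat b → toℕ ix < w j

hatSide : (f : Bool → End) → complementary (f false) (f true) → ∃₂ λ s b → f s ≡ hat b
hatSide f c with f false in f₀ | f true in f₁
hatSide f () | plain _ | plain _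
hatSide f _  | plain _ | hat b   = true , b , f₁
hatSide f _  | hat b   | plain _ = false , b , f₀
hatSide f () | hat _   | hat _

module _ {G : Graph} {k : ℕ} {P : Pot k} (r : Realization G P) where
  open Graph G
  open Realization r
  open Assignment assignment

  slotOf : HalfEdge G → Fin n × ℕ
  slotOf h = endpoint G h , toℕ (Inverse.from (ends (endpoint G h)) (h , refl))

  slotOf-injective : Injective _≡_ _≡_ slotOf
  slotOf-injective {h} {h′} eq = sameSlot (h , refl) (h′ , refl) (cong proj₁ eq) (cong proj₂ eq)
    where
    sameSlot : ∀ {v v′} (x : HalfEdgeAt G v) (x′ : HalfEdgeAt G v′) → v ≡ v′ →
               toℕ (Inverse.from (ends v) x) ≡ toℕ (Inverse.from (ends v′) x′) → proj₁ x ≡ proj₁ x′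
    sameSlot {v} x x′ refl eq = begin
      proj₁ x                                              ≡⟨ cong proj₁ (Inverse.strictlyInverseˡ (ends v) x) ⟨
      proj₁ (Inverse.to (ends v) (Inverse.from (ends v) x))  ≡⟨ cong (proj₁ ∘ Inverse.to (ends v)) (toℕ-injective eq) ⟩
      proj₁ (Inverse.to (ends v) (Inverse.from (ends v) x′)) ≡⟨ cong proj₁ (Inverse.strictlyInverseˡ (ends v) x′) ⟩
      proj₁ x′                                             ∎
      where open ≡-Reasoning

  hatEnd : (i : Edge G) → ∃₂ λ s b → labelOf assignment (i , s) ≡ hat b
  hatEnd i = hatSide (λ s → labelOf assignment (i , s)) (compatible i)

  hatSlot : Edge G → Fin n × ℕ
  hatSlot i = slotOf (i , proj₁ (hatEnd i))

  ∣E∣≤hatSlots : (w : Fin k → ℕ) → HatsWithin P w → length edges ≤ sum (map (w ∘ tileOf) (allFin n))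
  ∣E∣≤hatSlots w hatsWithin = subst (length edges ≤_) (length-slots (w ∘ tileOf) (allFin n))
    (injective-into-list⇒≤ (slots (w ∘ tileOf) (allFin n)) hatSlot
      (cong proj₁ ∘ slotOf-injective)
      λ i → let (s , b , hat≡) = hatEnd i; v = endpoint G (i , s) in
            ∈-slots (w ∘ tileOf) (∈-allFin v) (hatsWithin (tileOf v) _ hat≡))

hatCount : ℕ → Fin 3 → ℕ
hatCount e₂ zero             = 0
hatCount e₂ (suc zero)       = e₂
hatCount e₂ (suc (suc zero)) = 1

pot4-hatsWithin : ∀ e₁ e₂ → HatsWithin (pot4 e₁ e₂) (hatCount e₂)
pot4-hatsWithin e₁ e₂ zero ix plain≡hat =
  contradiction (trans (sym (All.lookup (replicate⁺ {P = _≡ plain a} e₁ refl) (∈-lookup ix))) plain≡hat) λ ()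
pot4-hatsWithin e₁ e₂ (suc zero)       ix _ = subst (toℕ ix <_) (length-replicate e₂) (toℕ<n ix)
pot4-hatsWithin e₁ e₂ (suc (suc zero)) ix _ = toℕ<n ix

module _ {n : ℕ} (t : Fin n → Fin 3) where

  count : Fin 3 → List (Fin n) → ℕ
  count j vs = length (filter (λ v → t v ≟ j) vs)

  -- Vertex by vertex: hatCount (1 + d) j + [j = t₁] = 1 + [j = t₂] · d.
  sum-hatCount : ∀ d vs → sum (map (hatCount (suc d) ∘ t) vs) + count zero vs ≡ length vs + count (suc zero) vs * d
  sum-hatCount d []       = refl
  sum-hatCount d (v ∷ vs) with t v | sum-hatCount d vs
  ... | zero           | ih = trans (+-suc _ (count zero vs)) (cong suc ih)
  ... | suc zero       | ih = cong suc (begin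
    d + sum (map (hatCount (suc d) ∘ t) vs) + count zero vs ≡⟨ +-assoc d _ _ ⟩
    d + (sum (map (hatCount (suc d) ∘ t) vs) + count zero vs) ≡⟨ cong (d +_) ih ⟩
    d + (length vs + count (suc zero) vs * d)                ≡⟨ x∙yz≈y∙xz d (length vs) _ ⟩
    length vs + (d + count (suc zero) vs * d)                ∎)
    where open ≡-Reasoning
  ... | suc (suc zero) | ih = cong suc ih

theorem4 : (e₁ e₂ : ℕ) → e₂ ≤ e₁ → 1 < e₂ →
    (G : Graph) → (r : Realization G (pot4 e₁ e₂)) →
    1 + tileCount r (suc zero) * (e₂ ∸ 1) < tileCount r zero →
    Disconnected G
theorem4 e₁ zero    _ ()
theorem4 e₁ (suc d) _ _ G r hyp connected = <-irrefl refl (begin-strict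
  n + R₁               ≤⟨ +-monoˡ-≤ R₁ (≤-trans (connected⇒n≤1+∣E∣ G connected) (s≤s ∣E∣≤S)) ⟩
  suc (S + R₁)         ≡⟨ cong suc S+R₁≡n+R₂d ⟩
  suc (n + R₂ * d)     ≡⟨ +-suc n (R₂ * d) ⟨
  n + suc (R₂ * d)     <⟨ +-monoʳ-< n hyp ⟩
  n + R₁               ∎)
  where
  open Graph G
  open ≤-Reasoning
  tileOf : Fin n → Fin 3
  tileOf = Assignment.tileOf (Realization.assignment r)
  R₁ R₂ S : ℕ
  R₁ = tileCount r zero
  R₂ = tileCount r (suc zero)
  S = sum (map (hatCount (suc d) ∘ tileOf) (allFin n))
  ∣E∣≤S : length edges ≤ S
  ∣E∣≤S = ∣E∣≤hatSlots r (hatCount (suc d)) (pot4-hatsWithin e₁ (suc d))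
  S+R₁≡n+R₂d : S + R₁ ≡ n + R₂ * d
  S+R₁≡n+R₂d = trans (sum-hatCount tileOf d (allFin n)) (cong (_+ R₂ * d) (length-tabulate (λ v → v)))
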